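{- For all integers $m, n \geq 0$, $$j(m,n) = j(m-2,n-1) + k(m,n), \qquad k(m,n) = k(m-1,n-1) + j(m,n-m).$$
   Context: A 01-partition (jagged partition) of a non-negative integer $n$ is a finite sequence $(n_1,\dots,n_m)$ of non-negative integers with $\sum_i n_i = n$, whose last entry satisfies $n_m \geq 1$, and such that $n_j \geq n_{j+1}-1$ and $n_j \geq n_{j+2}$ whenever the indices are in range; $m$ is its length (number of parts). The empty sequence is the unique 01-partition of $0$, of length $0$. $j(m,n)$ is the number of 01-partitions of $n$ of length exactly $m$, and $k(m,n)$ is the number of 01-partitions of $n$ of length exactly $m$ all of whose parts are $\geq 1$. By convention $j(m,n)=k(m,n)=0$ if $m<0$ or $n<0$ (so $j(0,0)=k(0,0)=1$). -}

module Defs where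

open import Data.Nat using (ℕ; zero; suc; _≤_; _≤?_)
open import Data.Integer using (ℤ; +_; -[1+_])
open import Data.List using (List; []; _∷_; [_]; map; concatMap; upTo; length; filter)
open import Data.Nat.ListAction using (sum)
open import Data.List.Relation.Unary.All using (All; all?)
open import Data.Product using (_×_)
open import Data.Product.Properties using ()
open import Data.Unit using (⊤)
open import Relation.Binary.PropositionalEquality using (_≡_)
open import Relation.Nullary using (Dec; yes)
open import Relation.Nullary.Decidable using (_×-dec_)
import Data.Nat.Properties as ℕP

JaggedCond : List ℕ → Set
JaggedCond (a ∷ b ∷ c ∷ r) = b ≤ suc a × c ≤ a × JaggedCond (b ∷ c ∷ r)
JaggedCond (a ∷ b ∷ []) = b ≤ suc a
JaggedCond (a ∷ []) = ⊤
JaggedCond [] = ⊤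

LastPos : List ℕ → Set
LastPos [] = ⊤
LastPos (a ∷ []) = 1 ≤ a
LastPos (a ∷ b ∷ r) = LastPos (b ∷ r)

Is01Partition : ℕ → List ℕ → Set
Is01Partition n l = sum l ≡ n × LastPos l × JaggedCond l

Is01PartitionPos : ℕ → List ℕ → Set
Is01PartitionPos n l = Is01Partition n l × All (1 ≤_) l

jaggedCond? : (l : List ℕ) → Dec (JaggedCond l)
jaggedCond? (a ∷ b ∷ c ∷ r) = (b ≤? suc a) ×-dec ((c ≤? a) ×-dec jaggedCond? (b ∷ c ∷ r))
jaggedCond? (a ∷ b ∷ []) = b ≤? suc a
jaggedCond? (a ∷ []) = yes _
jaggedCond? [] = yes _

lastPos? : (l : List ℕ) → Dec (LastPos l)
lastPos? [] = yes _
lastPos? (a ∷ []) = 1 ≤? a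
lastPos? (a ∷ b ∷ r) = lastPos? (b ∷ r)

is01Partition? : (n : ℕ) → (l : List ℕ) → Dec (Is01Partition n l)
is01Partition? n l = (sum l ℕP.≟ n) ×-dec (lastPos? l ×-dec jaggedCond? l)

is01PartitionPos? : (n : ℕ) → (l : List ℕ) → Dec (Is01PartitionPos n l)
is01PartitionPos? n l = is01Partition? n l ×-dec all? (1 ≤?_) l

listsBounded : ℕ → ℕ → List (List ℕ)
listsBounded zero b = [ [] ]
listsBounded (suc m) b = concatMap (λ x → map (x ∷_) (listsBounded m b)) (upTo (suc b))

-- Every 01-partition of n of length m has all entries ≤ n, so it occurs
-- (exactly once) in listsBounded m n; counting by filtering is exact.
jℕ : ℕ → ℕ → ℕ
jℕ m n = length (filter (is01Partition? n) (listsBounded m n))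

kℕ : ℕ → ℕ → ℕ
kℕ m n = length (filter (is01PartitionPos? n) (listsBounded m n))

j : ℤ → ℤ → ℕ
j (+ m) (+ n) = jℕ m n
j (+ m) -[1+ n ] = 0
j -[1+ m ] _ = 0

k : ℤ → ℤ → ℕ
k (+ m) (+ n) = kℕ m n
k (+ m) -[1+ n ] = 0
k -[1+ m ] _ = 0

{-# OPTIONS --safe #-}
-- A zero part of a 01-partition forces a zero two places later, and so on up to the end; since the last
-- part is positive it follows a zero and is therefore 1. So a 01-partition with a zero part ends in (0, 1),
-- and deleting that tail is a bijection onto the 01-partitions of n − 1 with m − 2 parts; the others have
-- all parts positive, which gives the first recurrence. A 01-partition with positive parts either ends in
-- 1, which can be deleted, or ends in a part ≥ 2, and then lowering every part by 1 is a bijection onto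
-- the 01-partitions of n − m with m parts (the local conditions are translation invariant); this gives the
-- second recurrence. The counts enumerate lists with entries bounded by n, which is harmless since no part
-- of a 01-partition exceeds its sum.
module Submission where

open import Defs
open import Data.Bool using (true; false)
open import Data.List using (List; []; _∷_; _++_; _∷ʳ_; length; map; concatMap; filter; applyUpTo; upTo; take; drop)
open import Data.List.Properties
  using (length-++; length-++-≤ʳ; map-++; filter-++; filter-none; map-upTo; applyUpTo-∷ʳ; ≡-dec; ∷-injective; take++drop≡id)
open import Data.List.Relation.Unary.All as All using (All; []; _∷_; all?)
open import Data.List.Relation.Unary.All.Properties using (concat⁺; map⁺; ++⁻ˡ; ++⁻ʳ; ∷ʳ⁺; ¬All⇒Any¬)
open import Data.List.Relation.Unary.Any as Any using (Any; here; there)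
open import Data.Nat
  using (ℕ; zero; suc; pred; _+_; _∸_; _≤_; _<_; _≤′_; ≤′-refl; ≤′-step; z≤n; s≤s; z<s; s<s; _≟_; _≤?_)
open import Data.Nat.ListAction using (sum)
open import Data.Nat.ListAction.Properties using (sum-++)
open import Data.Nat.Properties
  using (+-identityʳ; +-comm; +-assoc; +-suc; +-cancelˡ-≡; +-cancelʳ-≡; suc-injective; +-mono-≤;
         ≤-trans; ≤-antisym; ≤-pred; <-irrefl; m≤m+n; m≤n+m; n≤0⇒n≡0; n<1⇒n≡0; ≰⇒>; ≤⇒≤′; ≤′⇒≤;
         m+[n∸m]≡n; m∸n≤m)
import Data.Product as Product
open import Data.Product using (_×_; _,_; proj₁; proj₂; ∃-syntax)
open import Data.Unit using (tt)
open import Function using (_∘_; id; _⇔_; mk⇔; Equivalence)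
import Function.Properties.Equivalence as ⇔
open import Level using (0ℓ)
open import Relation.Binary.PropositionalEquality
open import Relation.Nullary using (Dec; yes; no; does; ¬_; contradiction)
open import Relation.Nullary.Decidable using (_×-dec_)
open import Relation.Unary using (Pred; Decidable; _∩_; ∁)
open import Relation.Unary.Properties using (_∩?_; ∁?)

open Equivalence

private variable
  P Q R : Pred (List ℕ) 0ℓ
  m n b d x : ℕ
  w z : List ℕ

-- Counting lists of given length and bounded entries

count : Decidable P → ℕ → ℕ → ℕ
count P? m b = length (filter P? (listsBounded m b))

module _ (P? : Decidable P) where

  length-filter-∩-∁ : (Q? : Decidable Q) (xs : List (List ℕ)) →
    length (filter P? xs) ≡ length (filter (P? ∩? Q?) xs) + length (filter (P? ∩? ∁? Q?) xs)
  length-filter-∩-∁ Q? [] = refl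
  length-filter-∩-∁ Q? (x ∷ xs) with P? x | Q? x
  ... | yes _ | yes _ = cong suc (length-filter-∩-∁ Q? xs)
  ... | yes _ | no _  = trans (cong suc (length-filter-∩-∁ Q? xs)) (sym (+-suc _ _))
  ... | no _  | _     = length-filter-∩-∁ Q? xs

  length-filter-map : ∀ (f : List ℕ → List ℕ) xs → length (filter P? (map f xs)) ≡ length (filter (P? ∘ f) xs)
  length-filter-map f [] = refl
  length-filter-map f (x ∷ xs) with does (P? (f x))
  ... | true  = cong suc (length-filter-map f xs)
  ... | false = length-filter-map f xs

  length-filter-concatMap : ∀ {A : Set} (f : A → List (List ℕ)) xs →
    length (filter P? (concatMap f xs)) ≡ sum (map (λ x → length (filter P? (f x))) xs)
  length-filter-concatMap f [] = refl
  length-filter-concatMap f (x ∷ xs) = begin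
    length (filter P? (f x ++ concatMap f xs))                   ≡⟨ cong length (filter-++ P? (f x) _) ⟩
    length (filter P? (f x) ++ filter P? (concatMap f xs))       ≡⟨ length-++ (filter P? (f x)) ⟩
    length (filter P? (f x)) + length (filter P? (concatMap f xs))
      ≡⟨ cong (length (filter P? (f x)) +_) (length-filter-concatMap f xs) ⟩
    length (filter P? (f x)) + sum (map (λ x → length (filter P? (f x))) xs) ∎
    where open ≡-Reasoning

filter-cong : (P? : Decidable P) (Q? : Decidable Q) {xs : List (List ℕ)} →
  All (λ z → P z ⇔ Q z) xs → filter P? xs ≡ filter Q? xs
filter-cong P? Q? [] = refl
filter-cong P? Q? {x ∷ _} (P⇔Q ∷ eqs) with P? x | Q? x
... | yes _  | yes _  = cong (x ∷_) (filter-cong P? Q? eqs)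
... | no _   | no _   = filter-cong P? Q? eqs
... | yes p  | no ¬q  = contradiction (to P⇔Q p) ¬q
... | no ¬p  | yes q  = contradiction (from P⇔Q q) ¬p

sum-applyUpTo-cong : ∀ {f g : ℕ → ℕ} n → (∀ {x} → x < n → f x ≡ g x) →
  sum (applyUpTo f n) ≡ sum (applyUpTo g n)
sum-applyUpTo-cong zero f≗g = refl
sum-applyUpTo-cong (suc n) f≗g = cong₂ _+_ (f≗g z<s) (sum-applyUpTo-cong n (f≗g ∘ s<s))

sum-applyUpTo-∷ʳ : ∀ (f : ℕ → ℕ) n → sum (applyUpTo f (suc n)) ≡ sum (applyUpTo f n) + f n
sum-applyUpTo-∷ʳ f n = begin
  sum (applyUpTo f (suc n))             ≡⟨ cong sum (applyUpTo-∷ʳ f n) ⟨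
  sum (applyUpTo f n ∷ʳ f n)            ≡⟨ sum-++ (applyUpTo f n) _ ⟩
  sum (applyUpTo f n) + (f n + 0)       ≡⟨ cong (sum (applyUpTo f n) +_) (+-identityʳ (f n)) ⟩
  sum (applyUpTo f n) + f n             ∎
  where open ≡-Reasoning

sum-applyUpTo-zero : ∀ {f : ℕ → ℕ} n → (∀ {x} → x < n → f x ≡ 0) → sum (applyUpTo f n) ≡ 0
sum-applyUpTo-zero zero f≡0 = refl
sum-applyUpTo-zero (suc n) f≡0 = cong₂ _+_ (f≡0 z<s) (sum-applyUpTo-zero n (f≡0 ∘ s<s))

sum-applyUpTo-single : ∀ {f : ℕ → ℕ} {y} n → y < n → (∀ {x} → x < n → x ≢ y → f x ≡ 0) →
  sum (applyUpTo f n) ≡ f y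
sum-applyUpTo-single {f} {zero} (suc n) _ f≡0 =
  trans (cong (f 0 +_) (sum-applyUpTo-zero n λ x<n → f≡0 (s<s x<n) λ ())) (+-identityʳ _)
sum-applyUpTo-single {f} {suc y} (suc n) (s<s y<n) f≡0 =
  trans (cong (_+ sum (applyUpTo (f ∘ suc) n)) (f≡0 z<s λ ()))
        (sum-applyUpTo-single n y<n λ x<n x≢y → f≡0 (s<s x<n) (x≢y ∘ cong pred))

listsBounded-length : ∀ m b → All (λ z → length z ≡ m) (listsBounded m b)
listsBounded-length zero b = refl ∷ []
listsBounded-length (suc m) b =
  concat⁺ (map⁺ (All.universal (λ x → map⁺ (All.map (cong suc) (listsBounded-length m b))) (upTo (suc b))))

count-cong : (P? : Decidable P) (Q? : Decidable Q) →
  (∀ {z} → length z ≡ m → P z ⇔ Q z) → count P? m b ≡ count Q? m b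
count-cong {m = m} {b = b} P? Q? P⇔Q =
  cong length (filter-cong P? Q? (All.map P⇔Q (listsBounded-length m b)))

count-empty : (P? : Decidable P) → (∀ {z} → length z ≡ m → ¬ P z) → count P? m b ≡ 0
count-empty {m = m} {b = b} P? ¬P = cong length (filter-none P? (All.map ¬P (listsBounded-length m b)))

count-∩-∁ : (P? : Decidable P) (Q? : Decidable Q) →
  count P? m b ≡ count (P? ∩? Q?) m b + count (P? ∩? ∁? Q?) m b
count-∩-∁ {m = m} {b = b} P? Q? = length-filter-∩-∁ P? Q? (listsBounded m b)

count-∷ : (P? : Decidable P) → count P? (suc m) b ≡ sum (applyUpTo (λ x → count (λ z → P? (x ∷ z)) m b) (suc b))
count-∷ {m = m} {b = b} P? = begin
  count P? (suc m) b
    ≡⟨ length-filter-concatMap P? (λ x → map (x ∷_) (listsBounded m b)) (upTo (suc b)) ⟩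
  sum (map (λ x → length (filter P? (map (x ∷_) (listsBounded m b)))) (upTo (suc b)))
    ≡⟨ cong sum (map-upTo _ (suc b)) ⟩
  sum (applyUpTo (λ x → length (filter P? (map (x ∷_) (listsBounded m b)))) (suc b))
    ≡⟨ sum-applyUpTo-cong (suc b) (λ {x} _ → length-filter-map P? (x ∷_) (listsBounded m b)) ⟩
  sum (applyUpTo (λ x → count (λ z → P? (x ∷ z)) m b) (suc b)) ∎
  where open ≡-Reasoning

_≟ₗ_ : (xs ys : List ℕ) → Dec (xs ≡ ys)
_≟ₗ_ = ≡-dec _≟_

count-singleton : ∀ {s} → All (_≤ b) s → count (_≟ₗ s) (length s) b ≡ 1
count-singleton [] = refl
count-singleton {b = b} {s = y ∷ s} (y≤b ∷ s≤b) = begin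
  count (_≟ₗ (y ∷ s)) (suc (length s)) b
    ≡⟨ count-∷ {m = length s} (_≟ₗ (y ∷ s)) ⟩
  sum (applyUpTo (λ x → count (λ z → (x ∷ z) ≟ₗ (y ∷ s)) (length s) b) (suc b))
    ≡⟨ sum-applyUpTo-single (suc b) (s≤s y≤b) (λ _ x≢y →
         count-empty {m = length s} (λ z → (_ ∷ z) ≟ₗ (y ∷ s)) λ _ → x≢y ∘ proj₁ ∘ ∷-injective) ⟩
  count (λ z → (y ∷ z) ≟ₗ (y ∷ s)) (length s) b
    ≡⟨ count-cong {m = length s} (λ z → (y ∷ z) ≟ₗ (y ∷ s)) (_≟ₗ s)
         (λ _ → mk⇔ (proj₂ ∘ ∷-injective) (cong (y ∷_))) ⟩
  count (_≟ₗ s) (length s) b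
    ≡⟨ count-singleton s≤b ⟩
  1 ∎
  where open ≡-Reasoning

count-take-drop : (P? : Decidable P) → ∀ {s} → All (_≤ b) s →
  count (λ z → P? (take m z) ×-dec (drop m z ≟ₗ s)) (m + length s) b ≡ count P? m b
count-take-drop {b = b} {m = zero} P? {s} s≤b with P? []
... | yes p = trans
  (count-cong {m = length s} {b = b} (λ z → yes p ×-dec (z ≟ₗ s)) (_≟ₗ s) (λ _ → mk⇔ proj₂ (p ,_)))
  (count-singleton s≤b)
... | no ¬p = count-empty {m = length s} (λ z → no ¬p ×-dec (z ≟ₗ s)) (λ _ → ¬p ∘ proj₁)
count-take-drop {b = b} {m = suc m} P? {s} s≤b = begin
  count (λ z → P? (take (suc m) z) ×-dec (drop (suc m) z ≟ₗ s)) (suc m + length s) b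
    ≡⟨ count-∷ {m = m + length s} (λ z → P? (take (suc m) z) ×-dec (drop (suc m) z ≟ₗ s)) ⟩
  sum (applyUpTo (λ x → count (λ z → P? (x ∷ take m z) ×-dec (drop m z ≟ₗ s)) (m + length s) b) (suc b))
    ≡⟨ sum-applyUpTo-cong (suc b) (λ {x} _ → count-take-drop {m = m} (λ z → P? (x ∷ z)) s≤b) ⟩
  sum (applyUpTo (λ x → count (λ z → P? (x ∷ z)) m b) (suc b))
    ≡⟨ count-∷ {m = m} {b = b} P? ⟨
  count P? (suc m) b ∎
  where open ≡-Reasoning

take-length-++ : ∀ (w : List ℕ) {s} → take (length w) (w ++ s) ≡ w
take-length-++ [] = refl
take-length-++ (x ∷ w) = cong (x ∷_) (take-length-++ w)

drop-length-++ : ∀ (w : List ℕ) {s} → drop (length w) (w ++ s) ≡ s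
drop-length-++ [] = refl
drop-length-++ (x ∷ w) = drop-length-++ w

++-suffix⇔take-drop : ∀ {s z} → length z ≡ m + length s →
  (∃[ w ] z ≡ w ++ s × P w) ⇔ (P (take m z) × drop m z ≡ s)
++-suffix⇔take-drop {m = m} {P = P} {s} {z} len = mk⇔ to′ from′
  where
  to′ : ∃[ w ] z ≡ w ++ s × P w → P (take m z) × drop m z ≡ s
  to′ (w , refl , pw) = subst (λ k → P (take k (w ++ s)) × drop k (w ++ s) ≡ s) |w|≡m
                          (subst P (sym (take-length-++ w)) pw , drop-length-++ w)
    where
    |w|≡m : length w ≡ m
    |w|≡m = +-cancelʳ-≡ (length s) (length w) m (trans (sym (length-++ w)) len)
  from′ : P (take m z) × drop m z ≡ s → ∃[ w ] z ≡ w ++ s × P w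
  from′ (p , refl) = take m z , sym (take++drop≡id m z) , p

count-suffix : (R? : Decidable R) (P? : Decidable P) → ∀ {s} → All (_≤ b) s →
  (∀ {z} → R z ⇔ (∃[ w ] z ≡ w ++ s × P w)) → count R? (length s + m) b ≡ count P? m b
count-suffix {b = b} {m = m} R? P? {s} s≤b R⇔ = begin
  count R? (length s + m) b
    ≡⟨ cong (λ k → count R? k b) (+-comm (length s) m) ⟩
  count R? (m + length s) b
    ≡⟨ count-cong R? (λ z → P? (take m z) ×-dec (drop m z ≟ₗ s))
         (λ len → ⇔.trans R⇔ (++-suffix⇔take-drop len)) ⟩
  count (λ z → P? (take m z) ×-dec (drop m z ≟ₗ s)) (m + length s) b
    ≡⟨ count-take-drop {m = m} P? s≤b ⟩
  count P? m b ∎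
  where open ≡-Reasoning

count-bound : (P? : Decidable P) → (∀ {z} → P z → All (_≤ b) z) → count P? m (suc b) ≡ count P? m b
count-bound {m = zero} P? bounded = refl
count-bound {b = b} {m = suc m} P? bounded = begin
  count P? (suc m) (suc b)
    ≡⟨ count-∷ {m = m} P? ⟩
  sum (applyUpTo (λ x → count (λ z → P? (x ∷ z)) m (suc b)) (suc (suc b)))
    ≡⟨ sum-applyUpTo-∷ʳ (λ x → count (λ z → P? (x ∷ z)) m (suc b)) (suc b) ⟩
  sum (applyUpTo (λ x → count (λ z → P? (x ∷ z)) m (suc b)) (suc b)) + count (λ z → P? (suc b ∷ z)) m (suc b)
    ≡⟨ cong₂ _+_ (sum-applyUpTo-cong (suc b) λ {x} _ →
                    count-bound {m = m} (λ z → P? (x ∷ z)) (All.tail ∘ bounded))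
                 (count-empty {m = m} (λ z → P? (suc b ∷ z)) λ _ p → <-irrefl refl (All.head (bounded p))) ⟩
  sum (applyUpTo (λ x → count (λ z → P? (x ∷ z)) m b) (suc b)) + 0
    ≡⟨ +-identityʳ _ ⟩
  sum (applyUpTo (λ x → count (λ z → P? (x ∷ z)) m b) (suc b))
    ≡⟨ count-∷ {m = m} {b = b} P? ⟨
  count P? (suc m) b ∎
  where open ≡-Reasoning

count-bound-≤ : ∀ {b′} (P? : Decidable P) → b ≤ b′ → (∀ {z} → P z → All (_≤ b) z) →
  count P? m b′ ≡ count P? m b
count-bound-≤ {b = b} {m = m} P? b≤b′ bounded = go (≤⇒≤′ b≤b′)
  where
  go : ∀ {b′} → b ≤′ b′ → count P? m b′ ≡ count P? m b
  go ≤′-refl = refl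
  go (≤′-step b≤′b′) =
    trans (count-bound {m = m} P? (All.map (λ x≤b → ≤-trans x≤b (≤′⇒≤ b≤′b′)) ∘ bounded))
          (go b≤′b′)

positive? : Decidable (All (1 ≤_))
positive? = all? (1 ≤?_)

-- On lists with positive entries map pred inverts map suc, so Shifted P is the image of P under map suc.
Shifted : Pred (List ℕ) 0ℓ → Pred (List ℕ) 0ℓ
Shifted P z = All (1 ≤_) z × P (map pred z)

shifted? : Decidable P → Decidable (Shifted P)
shifted? P? z = positive? z ×-dec P? (map pred z)

count-shifted : (P? : Decidable P) → count (shifted? P?) m (suc b) ≡ count P? m b
count-shifted {m = zero} {b = b} P? =
  count-cong {m = 0} {b = b} (shifted? P?) P? λ { {[]} _ → mk⇔ proj₂ ([] ,_) ; {_ ∷ _} () }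
count-shifted {m = suc m} {b = b} P? = begin
  count (shifted? P?) (suc m) (suc b)
    ≡⟨ count-∷ {m = m} (shifted? P?) ⟩
  count (λ z → shifted? P? (0 ∷ z)) m (suc b)
    + sum (applyUpTo (λ y → count (λ z → shifted? P? (suc y ∷ z)) m (suc b)) (suc b))
    ≡⟨ cong₂ _+_ (count-empty {m = m} (λ z → shifted? P? (0 ∷ z)) λ _ → λ { ((() ∷ _) , _) })
                 (sum-applyUpTo-cong (suc b) λ {y} _ → count-shifted-∷ y) ⟩
  sum (applyUpTo (λ y → count (λ z → P? (y ∷ z)) m b) (suc b))
    ≡⟨ count-∷ {m = m} {b = b} P? ⟨
  count P? (suc m) b ∎
  where
  open ≡-Reasoning
  count-shifted-∷ : ∀ y → count (λ z → shifted? P? (suc y ∷ z)) m (suc b) ≡ count (λ z → P? (y ∷ z)) m b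
  count-shifted-∷ y = trans
    (count-cong {m = m} (λ z → shifted? P? (suc y ∷ z)) (shifted? (λ z → P? (y ∷ z)))
      (λ _ → mk⇔ (Product.map₁ All.tail) (Product.map₁ (s≤s z≤n ∷_))))
    (count-shifted {m = m} (λ z → P? (y ∷ z)))

-- Local structure of 01-partitions

JaggedCond-tail : ∀ l → JaggedCond (x ∷ l) → JaggedCond l
JaggedCond-tail [] _ = tt
JaggedCond-tail (_ ∷ []) _ = tt
JaggedCond-tail (_ ∷ _ ∷ _) (_ , _ , jc) = jc

JaggedCond-++⁻ˡ : ∀ w {s} → JaggedCond (w ++ s) → JaggedCond w
JaggedCond-++⁻ˡ [] _ = tt
JaggedCond-++⁻ˡ (_ ∷ []) _ = tt
JaggedCond-++⁻ˡ (_ ∷ _ ∷ []) {[]} y≤1+x = y≤1+x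
JaggedCond-++⁻ˡ (_ ∷ _ ∷ []) {_ ∷ _} (y≤1+x , _) = y≤1+x
JaggedCond-++⁻ˡ (_ ∷ y ∷ c ∷ r) (y≤1+x , c≤x , jc) = y≤1+x , c≤x , JaggedCond-++⁻ˡ (y ∷ c ∷ r) jc

LastPos-++ : ∀ w {x s} → LastPos (w ++ x ∷ s) ≡ LastPos (x ∷ s)
LastPos-++ [] = refl
LastPos-++ (_ ∷ []) = refl
LastPos-++ (_ ∷ y ∷ w) = LastPos-++ (y ∷ w)

All-positive⇒LastPos : All (1 ≤_) z → LastPos z
All-positive⇒LastPos [] = tt
All-positive⇒LastPos (1≤x ∷ []) = 1≤x
All-positive⇒LastPos (_ ∷ ps@(_ ∷ _)) = All-positive⇒LastPos ps

All≤sum : ∀ z → All (_≤ sum z) z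
All≤sum [] = []
All≤sum (x ∷ z) = m≤m+n x (sum z) ∷ All.map (λ y≤ → ≤-trans y≤ (m≤n+m (sum z) x)) (All≤sum z)

Is01Partition⇒All≤ : Is01Partition n z → All (_≤ n) z
Is01Partition⇒All≤ {z = z} (refl , _) = All≤sum z

length≤sum : All (1 ≤_) z → length z ≤ sum z
length≤sum [] = z≤n
length≤sum (1≤x ∷ ps) = +-mono-≤ 1≤x (length≤sum ps)

Any-zero⇒ends-01 : ∀ z → JaggedCond z → LastPos z → Any (_≡ 0) z → ∃[ w ] z ≡ w ++ 0 ∷ 1 ∷ []
Any-zero⇒ends-01 (_ ∷ []) _ () (here refl)
Any-zero⇒ends-01 (_ ∷ _ ∷ []) y≤1 1≤y (here refl) = [] , cong (λ y → 0 ∷ y ∷ []) (≤-antisym y≤1 1≤y)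
Any-zero⇒ends-01 (_ ∷ _ ∷ []) _ () (there (here refl))
Any-zero⇒ends-01 (x ∷ y ∷ c ∷ r) (_ , c≤0 , jc) lp (here refl)
  with Any-zero⇒ends-01 (y ∷ c ∷ r) jc lp (there (here (n≤0⇒n≡0 c≤0)))
... | w , eq = x ∷ w , cong (x ∷_) eq
Any-zero⇒ends-01 (x ∷ y ∷ c ∷ r) (_ , _ , jc) lp (there zero∈) with Any-zero⇒ends-01 (y ∷ c ∷ r) jc lp zero∈
... | w , eq = x ∷ w , cong (x ∷_) eq

JaggedCond-++-01⁺ : ∀ w → JaggedCond w → LastPos w → JaggedCond (w ++ 0 ∷ 1 ∷ [])
JaggedCond-++-01⁺ [] _ _ = s≤s z≤n
JaggedCond-++-01⁺ (_ ∷ []) _ 1≤x = z≤n , 1≤x , s≤s z≤n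
JaggedCond-++-01⁺ (_ ∷ _ ∷ []) y≤1+x 1≤y = y≤1+x , z≤n , z≤n , 1≤y , s≤s z≤n
JaggedCond-++-01⁺ (_ ∷ y ∷ c ∷ r) (y≤1+x , c≤x , jc) lp = y≤1+x , c≤x , JaggedCond-++-01⁺ (y ∷ c ∷ r) jc lp

JaggedCond-++-01⁻ : ∀ w → JaggedCond (w ++ 0 ∷ 1 ∷ []) → LastPos w
JaggedCond-++-01⁻ [] _ = tt
JaggedCond-++-01⁻ (_ ∷ []) (_ , 1≤x , _) = 1≤x
JaggedCond-++-01⁻ (_ ∷ y ∷ w) jc = JaggedCond-++-01⁻ (y ∷ w) (JaggedCond-tail (y ∷ w ++ 0 ∷ 1 ∷ []) jc)

JaggedCond-∷ʳ-1 : All (1 ≤_) w → JaggedCond w → JaggedCond (w ∷ʳ 1)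
JaggedCond-∷ʳ-1 [] _ = tt
JaggedCond-∷ʳ-1 (_ ∷ []) _ = s≤s z≤n
JaggedCond-∷ʳ-1 (1≤x ∷ _ ∷ []) y≤1+x = y≤1+x , 1≤x , s≤s z≤n
JaggedCond-∷ʳ-1 (_ ∷ ps@(_ ∷ _ ∷ _)) (y≤1+x , c≤x , jc) = y≤1+x , c≤x , JaggedCond-∷ʳ-1 ps jc

JaggedCond-map-pred⁺ : All (1 ≤_) z → JaggedCond z → JaggedCond (map pred z)
JaggedCond-map-pred⁺ [] _ = tt
JaggedCond-map-pred⁺ (_ ∷ []) _ = tt
JaggedCond-map-pred⁺ (s≤s _ ∷ s≤s _ ∷ []) y≤1+x = ≤-pred y≤1+x
JaggedCond-map-pred⁺ (s≤s _ ∷ ps@(s≤s _ ∷ s≤s _ ∷ _)) (y≤1+x , c≤x , jc) =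
  ≤-pred y≤1+x , ≤-pred c≤x , JaggedCond-map-pred⁺ ps jc

JaggedCond-map-pred⁻ : All (1 ≤_) z → JaggedCond (map pred z) → JaggedCond z
JaggedCond-map-pred⁻ [] _ = tt
JaggedCond-map-pred⁻ (_ ∷ []) _ = tt
JaggedCond-map-pred⁻ (s≤s _ ∷ s≤s _ ∷ []) y≤1+x = s≤s y≤1+x
JaggedCond-map-pred⁻ (s≤s _ ∷ ps@(s≤s _ ∷ s≤s _ ∷ _)) (y≤1+x , c≤x , jc) =
  s≤s y≤1+x , s≤s c≤x , JaggedCond-map-pred⁻ ps jc

sum-map-pred : All (1 ≤_) z → length z + sum (map pred z) ≡ sum z
sum-map-pred [] = refl
sum-map-pred {suc x ∷ z} (_ ∷ ps) = cong suc (begin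
  length z + (x + sum (map pred z)) ≡⟨ +-assoc (length z) x _ ⟨
  length z + x + sum (map pred z)   ≡⟨ cong (_+ sum (map pred z)) (+-comm (length z) x) ⟩
  x + length z + sum (map pred z)   ≡⟨ +-assoc x (length z) _ ⟩
  x + (length z + sum (map pred z)) ≡⟨ cong (x +_) (sum-map-pred ps) ⟩
  x + sum z                         ∎)
  where open ≡-Reasoning

sum-++-comm : ∀ w {s} → sum (w ++ s) ≡ sum s + sum w
sum-++-comm w {s} = trans (sum-++ w s) (+-comm (sum w) (sum s))

HasZeroPart : ℕ → Pred (List ℕ) 0ℓ
HasZeroPart n = Is01Partition n ∩ ∁ (All (1 ≤_))

hasZeroPart? : ∀ n → Decidable (HasZeroPart n)
hasZeroPart? n = is01Partition? n ∩? ∁? positive?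

hasZeroPart⇒ends-01 : HasZeroPart n z → ∃[ w ] z ≡ w ++ 0 ∷ 1 ∷ []
hasZeroPart⇒ends-01 {z = z} ((_ , lp , jc) , ¬pos) =
  Any-zero⇒ends-01 z jc lp (Any.map (n<1⇒n≡0 ∘ ≰⇒>) (¬All⇒Any¬ (1 ≤?_) z ¬pos))

hasZeroPart-bounds : HasZeroPart n z → 2 ≤ length z × 1 ≤ n
hasZeroPart-bounds zp@((refl , _) , _) with hasZeroPart⇒ends-01 zp
... | w , refl = length-++-≤ʳ (0 ∷ 1 ∷ []) {w} , subst (1 ≤_) (sym (sum-++ w (0 ∷ 1 ∷ []))) (m≤n+m 1 (sum w))

Is01Partition-++-01 : Is01Partition (suc n) (w ++ 0 ∷ 1 ∷ []) ⇔ Is01Partition n w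
Is01Partition-++-01 {w = w} = mk⇔
  (λ (s , _ , jc) → suc-injective (trans (sym (sum-++-comm w)) s) , JaggedCond-++-01⁻ w jc , JaggedCond-++⁻ˡ w jc)
  (λ (s , lp , jc) →
     trans (sum-++-comm w) (cong suc s) , subst id (sym (LastPos-++ w)) (s≤s z≤n) , JaggedCond-++-01⁺ w jc lp)

hasZeroPart⇔ends-01 : HasZeroPart (suc n) z ⇔ (∃[ w ] z ≡ w ++ 0 ∷ 1 ∷ [] × Is01Partition n w)
hasZeroPart⇔ends-01 = mk⇔ to′ from′
  where
  to′ : HasZeroPart (suc n) z → ∃[ w ] z ≡ w ++ 0 ∷ 1 ∷ [] × Is01Partition n w
  to′ zp with hasZeroPart⇒ends-01 zp
  ... | w , refl = w , refl , to Is01Partition-++-01 (proj₁ zp)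
  from′ : ∃[ w ] z ≡ w ++ 0 ∷ 1 ∷ [] × Is01Partition n w → HasZeroPart (suc n) z
  from′ (w , refl , p) = from Is01Partition-++-01 p , (λ { (() ∷ _) }) ∘ ++⁻ʳ w

Is01PartitionPos-∷ʳ-1 : Is01PartitionPos (suc n) (w ∷ʳ 1) ⇔ Is01PartitionPos n w
Is01PartitionPos-∷ʳ-1 {w = w} = mk⇔
  (λ ((s , _ , jc) , pos) → let posʷ = ++⁻ˡ w pos in
     (suc-injective (trans (sym (sum-++-comm w)) s) , All-positive⇒LastPos posʷ , JaggedCond-++⁻ˡ w jc) , posʷ)
  (λ ((s , _ , jc) , pos) →
     (trans (sum-++-comm w) (cong suc s) , subst id (sym (LastPos-++ w)) (s≤s z≤n) , JaggedCond-∷ʳ-1 pos jc) ,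
     ∷ʳ⁺ pos (s≤s z≤n))

-- The last part is at least 2; the empty list qualifies vacuously, as it does for LastPos.
LastAtLeast2 : Pred (List ℕ) 0ℓ
LastAtLeast2 = LastPos ∘ map pred

lastAtLeast2? : Decidable LastAtLeast2
lastAtLeast2? = lastPos? ∘ map pred

¬LastAtLeast2⇒ends-1 : LastPos z → ¬ LastAtLeast2 z → ∃[ w ] z ≡ w ∷ʳ 1
¬LastAtLeast2⇒ends-1 {[]} _ ¬lp = contradiction tt ¬lp
¬LastAtLeast2⇒ends-1 {suc _ ∷ []} _ ¬lp = [] , cong (λ y → suc y ∷ []) (n<1⇒n≡0 (≰⇒> ¬lp))
¬LastAtLeast2⇒ends-1 {x ∷ y ∷ z} lp ¬lp with ¬LastAtLeast2⇒ends-1 {y ∷ z} lp ¬lp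
... | w , eq = x ∷ w , cong (x ∷_) eq

LastPartOne : ℕ → Pred (List ℕ) 0ℓ
LastPartOne n = Is01PartitionPos n ∩ ∁ LastAtLeast2

lastPartOne? : ∀ n → Decidable (LastPartOne n)
lastPartOne? n = is01PartitionPos? n ∩? ∁? lastAtLeast2?

lastPartOne⇔ends-1 : LastPartOne (suc n) z ⇔ (∃[ w ] z ≡ w ∷ʳ 1 × Is01PartitionPos n w)
lastPartOne⇔ends-1 {z = z} = mk⇔ to′ from′
  where
  to′ : LastPartOne (suc n) z → ∃[ w ] z ≡ w ∷ʳ 1 × Is01PartitionPos n w
  to′ (p@((_ , lp , _) , _) , ¬lp′) with ¬LastAtLeast2⇒ends-1 {z} lp ¬lp′
  ... | w , refl = w , refl , to Is01PartitionPos-∷ʳ-1 p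
  from′ : ∃[ w ] z ≡ w ∷ʳ 1 × Is01PartitionPos n w → LastPartOne (suc n) z
  from′ (w , refl , p) = from Is01PartitionPos-∷ʳ-1 p ,
    (λ ()) ∘ subst id (trans (cong LastPos (map-++ pred w (1 ∷ []))) (LastPos-++ (map pred w)))

Is01PartitionPos-map-pred : length z + d ≡ n → (Is01PartitionPos n ∩ LastAtLeast2) z ⇔ Shifted (Is01Partition d) z
Is01PartitionPos-map-pred {z = z} refl = mk⇔
  (λ (((s , _ , jc) , pos) , lp′) →
     pos , +-cancelˡ-≡ (length z) _ _ (trans (sum-map-pred pos) s) , lp′ , JaggedCond-map-pred⁺ pos jc)
  (λ (pos , s , lp′ , jc′) →
     ((trans (sym (sum-map-pred pos)) (cong (length z +_) s) , All-positive⇒LastPos pos , JaggedCond-map-pred⁻ pos jc′) ,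
      pos) , lp′)

-- The two recurrences

open import Data.Integer using (+_; -[1+_]; _-_; _⊖_; sign)
open import Data.Integer.Properties using (≤-⊖; sign-⊖-<)
import Data.Nat as N
import Data.Sign as Sign

j-negative : ∀ m i → sign i ≡ Sign.- → j (+ m) i ≡ 0
j-negative m -[1+ _ ] _ = refl

count-hasZeroPart-degenerate : ∀ m n → ¬ (2 ≤ m × 1 ≤ n) → count (hasZeroPart? n) m n ≡ 0
count-hasZeroPart-degenerate m n ¬2≤m×1≤n = count-empty {m = m} (hasZeroPart? n) λ len zp →
  ¬2≤m×1≤n (subst (2 ≤_) len (proj₁ (hasZeroPart-bounds zp)) , proj₂ (hasZeroPart-bounds zp))

count-hasZeroPart : ∀ m n → count (hasZeroPart? n) m n ≡ j (+ m - + 2) (+ n - + 1)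
count-hasZeroPart 0 n = count-hasZeroPart-degenerate 0 n λ { (() , _) }
count-hasZeroPart 1 n = count-hasZeroPart-degenerate 1 n λ { (s≤s () , _) }
count-hasZeroPart (suc (suc m)) zero = count-hasZeroPart-degenerate (2 + m) 0 λ { (_ , ()) }
count-hasZeroPart (suc (suc m)) (suc n) = begin
  count (hasZeroPart? (suc n)) (2 + m) (suc n)
    ≡⟨ count-suffix {m = m} (hasZeroPart? (suc n)) (is01Partition? n) (z≤n ∷ s≤s z≤n ∷ [])
         hasZeroPart⇔ends-01 ⟩
  count (is01Partition? n) m (suc n)
    ≡⟨ count-bound {m = m} (is01Partition? n) Is01Partition⇒All≤ ⟩
  jℕ m n ∎
  where open ≡-Reasoning

j-recurrence : ∀ m n → j (+ m) (+ n) ≡ j (+ m - + 2) (+ n - + 1) N.+ k (+ m) (+ n)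
j-recurrence m n = begin
  jℕ m n                                        ≡⟨ count-∩-∁ {m = m} (is01Partition? n) positive? ⟩
  kℕ m n + count (hasZeroPart? n) m n           ≡⟨ +-comm (kℕ m n) _ ⟩
  count (hasZeroPart? n) m n + kℕ m n           ≡⟨ cong (_+ kℕ m n) (count-hasZeroPart m n) ⟩
  j (+ m - + 2) (+ n - + 1) + kℕ m n            ∎
  where open ≡-Reasoning

count-lastPartOne : ∀ m n → count (lastPartOne? (suc n)) (suc m) (suc n) ≡ kℕ m n
count-lastPartOne m n = begin
  count (lastPartOne? (suc n)) (suc m) (suc n)
    ≡⟨ count-suffix {m = m} (lastPartOne? (suc n)) (is01PartitionPos? n) (s≤s z≤n ∷ []) lastPartOne⇔ends-1 ⟩
  count (is01PartitionPos? n) m (suc n)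
    ≡⟨ count-bound {m = m} (is01PartitionPos? n) (Is01Partition⇒All≤ ∘ proj₁) ⟩
  kℕ m n ∎
  where open ≡-Reasoning

count-lastAtLeast2 : ∀ m n →
  count (is01PartitionPos? (suc n) ∩? lastAtLeast2?) (suc m) (suc n) ≡ j (+ suc m) (+ suc n - + suc m)
count-lastAtLeast2 m n with m ≤? n
... | yes m≤n = begin
  count (is01PartitionPos? (suc n) ∩? lastAtLeast2?) (suc m) (suc n)
    ≡⟨ count-cong {m = suc m} (is01PartitionPos? (suc n) ∩? lastAtLeast2?) (shifted? (is01Partition? (n ∸ m)))
         (λ len → Is01PartitionPos-map-pred (trans (cong (_+ (n ∸ m)) len) (cong suc (m+[n∸m]≡n m≤n)))) ⟩
  count (shifted? (is01Partition? (n ∸ m))) (suc m) (suc n)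
    ≡⟨ count-shifted {m = suc m} (is01Partition? (n ∸ m)) ⟩
  count (is01Partition? (n ∸ m)) (suc m) n
    ≡⟨ count-bound-≤ {m = suc m} (is01Partition? (n ∸ m)) (m∸n≤m n m) Is01Partition⇒All≤ ⟩
  jℕ (suc m) (n ∸ m)
    ≡⟨ cong (j (+ suc m)) (≤-⊖ (s≤s m≤n)) ⟨
  j (+ suc m) (suc n ⊖ suc m) ∎
  where open ≡-Reasoning
... | no m≰n = trans
  (count-empty {m = suc m} (is01PartitionPos? (suc n) ∩? lastAtLeast2?) λ len (((s , _) , pos) , _) →
     m≰n (≤-pred (subst₂ _≤_ len s (length≤sum pos))))
  (sym (j-negative (suc m) (suc n ⊖ suc m) (sign-⊖-< (s≤s (≰⇒> m≰n)))))

k-recurrence : ∀ m n → k (+ m) (+ n) ≡ k (+ m - + 1) (+ n - + 1) N.+ j (+ m) (+ n - + m)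
k-recurrence zero n rewrite +-identityʳ n = sym (j-recurrence 0 n)
k-recurrence (suc m) zero = count-empty {m = suc m} (is01PartitionPos? 0) λ len ((s , _) , pos) →
  contradiction (subst₂ _≤_ len s (length≤sum pos)) λ ()
k-recurrence (suc m) (suc n) = begin
  kℕ (suc m) (suc n)      ≡⟨ count-∩-∁ {m = suc m} (is01PartitionPos? (suc n)) lastAtLeast2? ⟩
  lastAtLeast2 + lastOne  ≡⟨ +-comm lastAtLeast2 lastOne ⟩
  lastOne + lastAtLeast2  ≡⟨ cong₂ _+_ (count-lastPartOne m n) (count-lastAtLeast2 m n) ⟩
  kℕ m n + j (+ suc m) (+ suc n - + suc m) ∎
  where
  open ≡-Reasoning
  lastAtLeast2 lastOne : ℕ
  lastAtLeast2 = count (is01PartitionPos? (suc n) ∩? lastAtLeast2?) (suc m) (suc n)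
  lastOne = count (lastPartOne? (suc n)) (suc m) (suc n)

lemma15 : (m n : ℕ) →
    (j (+ m) (+ n) ≡ j (+ m - + 2) (+ n - + 1) N.+ k (+ m) (+ n))
    × (k (+ m) (+ n) ≡ k (+ m - + 1) (+ n - + 1) N.+ j (+ m) (+ n - + m))
lemma15 m n = j-recurrence m n , k-recurrence m n
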